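{- The global Kuroda principle is strictly stronger than the local Kuroda principle: every descriptive $\mathsf{MS4}$-frame satisfying the global Kuroda principle satisfies the local Kuroda principle, and there is a (finite) descriptive $\mathsf{MS4}$-frame satisfying the local Kuroda principle but not the global one.
   Context: An $\mathsf{MS4}$-frame is $(Y,R,E)$ with $R$ a quasi-order, $E$ an equivalence relation, and: if $xEy$ and $yRz$ then there is $u$ with $xRu$ and $uEz$. It is descriptive if $Y$ carries a Stone topology in which $R$ and $E$ are continuous ($S[x]=\{y:xSy\}$ closed for every $x$, $S^{ -1}[U]$ clopen for every clopen $U$). $\operatorname{qmax}Y=\{x:xRy\Rightarrow yRx\}$; $xE_Ry$ iff $xRy$ and $yRx$. Global Kuroda principle: for every $x\in\operatorname{qmax}Y$, $E[x]\subseteq\operatorname{qmax}Y$. Local Kuroda principle: for every $x\in\operatorname{qmax}Y$ there is $y$ with $xE_Ry$ and $E[y]\subseteq\operatorname{qmax}Y$. -}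

module Defs where

open import Data.Product using (Σ; ∃; ∃-syntax; _×_; _,_)
open import Data.Unit using (⊤)
open import Data.List using (List)
open import Data.List.Membership.Propositional using (_∈_)
open import Relation.Nullary using (¬_)
open import Relation.Binary.PropositionalEquality using (_≡_; _≢_)

Subset : Set → Set₁
Subset Y = Y → Set

record Topology (Y : Set) : Set₁ where
  field
    Open      : Subset Y → Set
    open-ext  : ∀ {U V : Subset Y} → (∀ y → U y → V y) → (∀ y → V y → U y) → Open U → Open V
    open-univ : Open (λ _ → ⊤)
    open-∩    : ∀ {U V} → Open U → Open V → Open (λ y → U y × V y)
    open-⋃    : ∀ (I : Set) (U : I → Subset Y) → (∀ i → Open (U i)) → Open (λ y → ∃[ i ] U i y)

  Closed : Subset Y → Set
  Closed C = Open (λ y → ¬ C y)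

  Clopen : Subset Y → Set
  Clopen C = Open C × Closed C

  Compact : Set₁
  Compact = ∀ (I : Set) (U : I → Subset Y) → (∀ i → Open (U i)) → (∀ y → ∃[ i ] U i y) →
            Σ (List I) λ is → ∀ y → ∃[ i ] (i ∈ is × U i y)

  Hausdorff : Set₁
  Hausdorff = ∀ (x y : Y) → x ≢ y →
              Σ (Subset Y) λ U → Σ (Subset Y) λ V →
                Open U × Open V × U x × V y × (∀ z → ¬ (U z × V z))

  ZeroDimensional : Set₁
  ZeroDimensional = ∀ (U : Subset Y) → Open U → ∀ x → U x →
                    Σ (Subset Y) λ C → Clopen C × C x × (∀ z → C z → U z)

record StoneTopology (Y : Set) : Set₁ where
  field
    top       : Topology Y
  open Topology top public
  field
    compact   : Compact
    hausdorff : Hausdorff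
    zeroDim   : ZeroDimensional

image : ∀ {Y : Set} → (Y → Y → Set) → Y → Subset Y
image S x = λ y → S x y

preimage : ∀ {Y : Set} → (Y → Y → Set) → Subset Y → Subset Y
preimage S U = λ x → ∃[ y ] (S x y × U y)

record Continuous {Y : Set} (T : StoneTopology Y) (S : Y → Y → Set) : Set₁ where
  open StoneTopology T
  field
    image-closed    : ∀ x → Closed (image S x)
    preimage-clopen : ∀ U → Clopen U → Clopen (preimage S U)

record MS4Frame (Y : Set) : Set₁ where
  field
    R       : Y → Y → Set
    E       : Y → Y → Set
    R-refl  : ∀ x → R x x
    R-trans : ∀ {x y z} → R x y → R y z → R x z
    E-refl  : ∀ x → E x x
    E-sym   : ∀ {x y} → E x y → E y x
    E-trans : ∀ {x y z} → E x y → E y z → E x z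
    commute : ∀ {x y z} → E x y → R y z → ∃[ u ] (R x u × E u z)

  qmax : Subset Y
  qmax x = ∀ y → R x y → R y x

  E-R : Y → Y → Set
  E-R x y = R x y × R y x

record DescriptiveMS4Frame (Y : Set) : Set₁ where
  field
    frame  : MS4Frame Y
    stone  : StoneTopology Y
  open MS4Frame frame public
  field
    R-continuous : Continuous stone R
    E-continuous : Continuous stone E

module _ {Y : Set} (F : DescriptiveMS4Frame Y) where
  open DescriptiveMS4Frame F

  GlobalKuroda : Set
  GlobalKuroda = ∀ x → qmax x → ∀ y → E x y → qmax y

  LocalKuroda : Set
  LocalKuroda = ∀ x → qmax x → ∃[ y ] (E-R x y × (∀ z → E y z → qmax z))

-- Global Kuroda gives local Kuroda with the point itself as witness.  The
-- converse fails on three points: 0 and 1 form one maximal R-cluster, 2 lies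
-- strictly below it, and E only identifies 0 with 2.  Local Kuroda holds (the
-- witness for 0 is 1, whose E-class is {1}), but the E-class of the
-- quasi-maximal point 0 contains the non-quasi-maximal point 2.
module Submission where

open import Defs
open import Function using (_∘_)
open import Data.Nat using (ℕ)
open import Data.Fin using (Fin; zero; suc)
open import Data.Product using (Σ; _×_; _,_; proj₁; proj₂; ∃-syntax)
open import Data.Unit using (⊤; tt)
open import Data.Empty using (⊥-elim)
open import Data.List using (List; map; allFin)
open import Data.List.Membership.Propositional using (_∈_)
open import Data.List.Membership.Propositional.Properties using (∈-map⁺; ∈-allFin)
open import Relation.Nullary using (¬_)
open import Relation.Binary.PropositionalEquality using (_≡_; refl)

globalKuroda⇒localKuroda : ∀ {Y} (F : DescriptiveMS4Frame Y) → GlobalKuroda F → LocalKuroda F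
globalKuroda⇒localKuroda F global x qmax-x = x , (R-refl x , R-refl x) , global x qmax-x
  where open DescriptiveMS4Frame F

module DiscreteStone {Y : Set} (elements : List Y) (∈-elements : ∀ y → y ∈ elements) where

  discrete : Topology Y
  discrete = record
    { Open = λ _ → ⊤ ; open-ext = λ _ _ _ → tt ; open-univ = tt
    ; open-∩ = λ _ _ → tt ; open-⋃ = λ _ _ _ → tt }

  open Topology discrete

  discrete-compact : Compact
  discrete-compact I U _ cover =
    map (proj₁ ∘ cover) elements , λ y → proj₁ (cover y) , ∈-map⁺ (proj₁ ∘ cover) (∈-elements y) , proj₂ (cover y)

  discrete-hausdorff : Hausdorff
  discrete-hausdorff x y x≢y =
    (_≡ x) , (_≡ y) , tt , tt , refl , refl , λ { _ (refl , refl) → x≢y refl }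

  discreteStone : StoneTopology Y
  discreteStone = record
    { top = discrete ; compact = discrete-compact ; hausdorff = discrete-hausdorff
    ; zeroDim = λ U _ x Ux → U , (tt , tt) , Ux , λ _ Uz → Uz }

  discrete-continuous : ∀ S → Continuous discreteStone S
  discrete-continuous S = record { image-closed = λ _ → tt ; preimage-clopen = λ _ _ → tt , tt }

module Counterexample where

  pattern p₀ = zero
  pattern p₁ = suc zero
  pattern p₂ = suc (suc zero)

  data _≤₃_ : Fin 3 → Fin 3 → Set where
    ≤₃-refl : ∀ {x} → x ≤₃ x
    p₀≤p₁ : p₀ ≤₃ p₁
    p₁≤p₀ : p₁ ≤₃ p₀
    p₂≤p₀ : p₂ ≤₃ p₀
    p₂≤p₁ : p₂ ≤₃ p₁

  data _~₃_ : Fin 3 → Fin 3 → Set where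
    ~₃-refl : ∀ {x} → x ~₃ x
    p₀~p₂ : p₀ ~₃ p₂
    p₂~p₀ : p₂ ~₃ p₀

  ≤₃-trans : ∀ {x y z} → x ≤₃ y → y ≤₃ z → x ≤₃ z
  ≤₃-trans ≤₃-refl q = q
  ≤₃-trans p ≤₃-refl = p
  ≤₃-trans p₀≤p₁ p₁≤p₀ = ≤₃-refl
  ≤₃-trans p₁≤p₀ p₀≤p₁ = ≤₃-refl
  ≤₃-trans p₂≤p₀ p₀≤p₁ = p₂≤p₁
  ≤₃-trans p₂≤p₁ p₁≤p₀ = p₂≤p₀

  ~₃-sym : ∀ {x y} → x ~₃ y → y ~₃ x
  ~₃-sym ~₃-refl = ~₃-refl
  ~₃-sym p₀~p₂ = p₂~p₀
  ~₃-sym p₂~p₀ = p₀~p₂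

  ~₃-trans : ∀ {x y z} → x ~₃ y → y ~₃ z → x ~₃ z
  ~₃-trans ~₃-refl q = q
  ~₃-trans p ~₃-refl = p
  ~₃-trans p₀~p₂ p₂~p₀ = ~₃-refl
  ~₃-trans p₂~p₀ p₀~p₂ = ~₃-refl

  ~₃-≤₃-commute : ∀ {x y z} → x ~₃ y → y ≤₃ z → ∃[ u ] (x ≤₃ u × u ~₃ z)
  ~₃-≤₃-commute ~₃-refl q = _ , q , ~₃-refl
  ~₃-≤₃-commute p₀~p₂ ≤₃-refl = p₀ , ≤₃-refl , p₀~p₂
  ~₃-≤₃-commute p₀~p₂ p₂≤p₀ = p₀ , ≤₃-refl , ~₃-refl
  ~₃-≤₃-commute p₀~p₂ p₂≤p₁ = p₁ , p₀≤p₁ , ~₃-refl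
  ~₃-≤₃-commute p₂~p₀ ≤₃-refl = p₂ , ≤₃-refl , p₂~p₀
  ~₃-≤₃-commute p₂~p₀ p₀≤p₁ = p₁ , p₂≤p₁ , ~₃-refl

  frame : MS4Frame (Fin 3)
  frame = record
    { R = _≤₃_ ; E = _~₃_ ; R-refl = λ _ → ≤₃-refl ; R-trans = ≤₃-trans
    ; E-refl = λ _ → ~₃-refl ; E-sym = ~₃-sym ; E-trans = ~₃-trans ; commute = ~₃-≤₃-commute }

  open DiscreteStone (allFin 3) ∈-allFin

  descriptiveFrame : DescriptiveMS4Frame (Fin 3)
  descriptiveFrame = record
    { frame = frame ; stone = discreteStone
    ; R-continuous = discrete-continuous _≤₃_ ; E-continuous = discrete-continuous _~₃_ }

  open MS4Frame frame using (qmax)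

  qmax-p₀ : qmax p₀
  qmax-p₀ p₀ ≤₃-refl = ≤₃-refl
  qmax-p₀ p₁ p₀≤p₁ = p₁≤p₀

  qmax-p₁ : qmax p₁
  qmax-p₁ p₀ p₁≤p₀ = p₀≤p₁
  qmax-p₁ p₁ ≤₃-refl = ≤₃-refl

  ¬qmax-p₂ : ¬ qmax p₂
  ¬qmax-p₂ q with q p₀ p₂≤p₀
  ... | ()

  localKuroda : LocalKuroda descriptiveFrame
  localKuroda p₀ _ = p₁ , (p₀≤p₁ , p₁≤p₀) , λ { p₁ ~₃-refl → qmax-p₁ }
  localKuroda p₁ _ = p₁ , (≤₃-refl , ≤₃-refl) , λ { p₁ ~₃-refl → qmax-p₁ }
  localKuroda p₂ qmax-p₂ = ⊥-elim (¬qmax-p₂ qmax-p₂)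

  ¬globalKuroda : ¬ GlobalKuroda descriptiveFrame
  ¬globalKuroda global = ¬qmax-p₂ (global p₀ qmax-p₀ p₂ p₀~p₂)

open Counterexample using (descriptiveFrame; localKuroda; ¬globalKuroda)

proposition4p3 :
    ((Y : Set) (F : DescriptiveMS4Frame Y) → GlobalKuroda F → LocalKuroda F)
    × (Σ ℕ λ n → Σ (DescriptiveMS4Frame (Fin n)) λ F → LocalKuroda F × ¬ GlobalKuroda F)
proposition4p3 =
  (λ _ → globalKuroda⇒localKuroda) , 3 , descriptiveFrame , localKuroda , ¬globalKuroda
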